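{- Let $n\ge 71$ and let $D$ be a minimal dominating set of $G_n\times G_n$ with $|D|>n^2$ such that $D_{00}$, $D_{10}$, $D_{01}$ are nonempty and $D_{11}$ is empty. Then $|D\setminus D_{00}|=|D_{10}|+|D_{01}|>2n-43$.
   Context: $G_n=K_2\,\square\,K_n$ is identified with vertex set $\mathbb{Z}_2\times\mathbb{Z}_n$, where $(a,b)$ and $(a',b')$ are adjacent iff exactly one of $a=a'$, $b=b'$ holds. The direct product $G\times H$ has vertex set $V(G)\times V(H)$, with $(u_G,u_H)$ adjacent to $(v_G,v_H)$ iff $u_Gv_G\in E(G)$ and $u_Hv_H\in E(H)$; so vertices of $G_n\times G_n$ are $4$-tuples $(a,b,c,d)\in\mathbb{Z}_2\times\mathbb{Z}_n\times\mathbb{Z}_2\times\mathbb{Z}_n$. For $i,j\in\{0,1\}$ let $N_{ij}=\{i\}\times\mathbb{Z}_n\times\{j\}\times\mathbb{Z}_n$ and $D_{ij}=D\cap N_{ij}$. A set $D$ is dominating if every vertex is in $D$ or adjacent to a vertex of $D$, and minimal if no proper subset is dominating. -}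

module Defs where

open import Data.Nat using (ℕ; _+_)
open import Data.Fin using (Fin; zero; suc)
open import Data.Bool using (Bool; true; false; if_then_else_)
open import Data.List using (List; map; allFin)
open import Data.Nat.ListAction using (sum)
open import Data.Product using (_×_; Σ; ∃; _,_)
open import Data.Sum using (_⊎_)
open import Relation.Binary.PropositionalEquality using (_≡_; _≢_)
open import Relation.Nullary using (¬_)

-- Vertices of G_n = K_2 □ K_n : Z_2 × Z_n
VG : ℕ → Set
VG n = Fin 2 × Fin n

AdjG : ∀ {n} → VG n → VG n → Set
AdjG (a , b) (a' , b') = (a ≡ a' × b ≢ b') ⊎ (a ≢ a' × b ≡ b')

V : ℕ → Set
V n = Fin 2 × Fin n × Fin 2 × Fin n

Adj : ∀ {n} → V n → V n → Set
Adj (a , b , c , d) (a' , b' , c' , d') =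
  AdjG (a , b) (a' , b') × AdjG (c , d) (c' , d')

VSet : ℕ → Set
VSet n = V n → Bool

_∈_ : ∀ {n} → V n → VSet n → Set
v ∈ D = D v ≡ true

_∉_ : ∀ {n} → V n → VSet n → Set
v ∉ D = D v ≡ false

_⊆_ : ∀ {n} → VSet n → VSet n → Set
D' ⊆ D = ∀ v → v ∈ D' → v ∈ D

Dominating : ∀ {n} → VSet n → Set
Dominating {n} D = ∀ (v : V n) → v ∈ D ⊎ Σ (V n) (λ u → u ∈ D × Adj v u)

MinimalDominating : ∀ {n} → VSet n → Set
MinimalDominating {n} D =
  Dominating D ×
  ¬ (Σ (VSet n) λ D' → D' ⊆ D × Σ (V n) (λ v → v ∈ D × v ∉ D') × Dominating D')

sumFin : ∀ n → (Fin n → ℕ) → ℕ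
sumFin n f = sum (map f (allFin n))

b2n : Bool → ℕ
b2n true = 1
b2n false = 0

card : ∀ {n} → VSet n → ℕ
card {n} D = sumFin 2 λ a → sumFin n λ b → sumFin 2 λ c → sumFin n λ d →
  b2n (D (a , b , c , d))

block : ∀ {n} → Fin 2 → Fin 2 → VSet n → VSet n
block i j D (a , b , c , d) with a Data.Fin.≟ i | c Data.Fin.≟ j
... | Relation.Nullary.yes _ | Relation.Nullary.yes _ = D (a , b , c , d)
... | _ | _ = false

_∖_ : ∀ {n} → VSet n → VSet n → VSet n
(D ∖ E) v = if E v then false else D v

NonEmpty : ∀ {n} → VSet n → Set
NonEmpty {n} D = Σ (V n) λ v → v ∈ D

Empty : ∀ {n} → VSet n → Set
Empty D = ∀ v → v ∉ D

module Submission where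

-- Let A be the 0/1 matrix of D₀₀ and Z its number of zeros. Since D₁₁ = ∅ and |D| > n², we get
-- |D₁₀| + |D₀₁| > Z, so if the bound fails then Z + 5 < 2n. A line (row or column) of A with at
-- most two entries has at least n − 2 zeros, hence at most one line of A is sparse in that case.
-- Minimality gives every x = (0,b,0,d) ∈ D₀₀ a private neighbour; checking its possible positions
-- in the four blocks shows that row b or column d of A is sparse as soon as column d meets D₁₀
-- outside row b or row b meets D₀₁ outside column d. Applied along the row of a vertex of D₀₁
-- and the column of a vertex of D₁₀ this produces a second sparse line.

open import Defs
open import Data.Nat using (ℕ; zero; suc; _+_; _*_; _∸_; _≤_; _<_; z≤n; s≤s; _≤?_; _<?_)
open import Data.Nat.Properties
  using (+-0-commutativeMonoid; +-commutativeSemigroup; module ≤-Reasoning; ≤-refl; ≤-reflexive; ≤-trans;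
         +-comm; +-assoc; +-suc; +-identityʳ; *-identityʳ; +-mono-≤; +-monoˡ-≤; +-monoʳ-≤; +-cancelˡ-<;
         m≤m+n; m≤n+m; n≤1+n; <⇒≱; ≮⇒≥; m≤o∸n⇒m+n≤o)
open import Algebra.Properties.CommutativeMonoid.Sum +-0-commutativeMonoid
  using (sum; sum-syntax; ∑-distrib-+; ∑-comm; sum-cong-≗; sum-replicate-zero)
open import Algebra.Properties.CommutativeSemigroup +-commutativeSemigroup
  using (x∙yz≈y∙xz; interchange)
open import Data.Bool using (Bool; true; false; not; if_then_else_)
import Data.Bool.Properties as Bool
open import Data.Fin using (Fin; zero; suc)
open import Data.Fin.Properties using (_≟_; any?)
open import Data.List using (map; tabulate)
import Data.Nat.ListAction as List
open import Data.Product using (Σ; ∃-syntax; _×_; _,_; proj₁)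
open import Data.Product.Properties using (≡-dec)
open import Data.Sum using (_⊎_; inj₁; inj₂)
open import Data.Empty using (⊥; ⊥-elim)
open import Function using (_∘_; id)
open import Relation.Binary.Definitions using (DecidableEquality)
open import Relation.Binary.PropositionalEquality
open import Relation.Nullary using (Dec; does; yes; no; ¬_; contradiction)
open import Relation.Nullary.Decidable using (_×-dec_; _⊎-dec_; ¬?; decidable-stable)

sum-map-tabulate : ∀ {A : Set} {k} (g : Fin k → A) (f : A → ℕ) →
                   List.sum (map f (tabulate g)) ≡ ∑[ i < k ] f (g i)
sum-map-tabulate {k = zero}  g f = refl
sum-map-tabulate {k = suc k} g f = cong (f (g zero) +_) (sum-map-tabulate (g ∘ suc) f)

sumFin≡sum : ∀ k (f : Fin k → ℕ) → sumFin k f ≡ sum f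
sumFin≡sum k f = sum-map-tabulate id f

sumFin-cong : ∀ k {f g : Fin k → ℕ} → (∀ i → f i ≡ g i) → sumFin k f ≡ sum g
sumFin-cong k {f} f≗g = trans (sumFin≡sum k f) (sum-cong-≗ f≗g)

sum-zero : ∀ {k} {f : Fin k → ℕ} → (∀ i → f i ≡ 0) → sum f ≡ 0
sum-zero {k} f≗0 = trans (sum-cong-≗ f≗0) (sum-replicate-zero k)

sum-const : ∀ k c → ∑[ i < k ] c ≡ k * c
sum-const zero    c = refl
sum-const (suc k) c = cong (c +_) (sum-const k c)

sum-mono-≤ : ∀ {k} {f g : Fin k → ℕ} → (∀ i → f i ≤ g i) → sum f ≤ sum g
sum-mono-≤ {zero}  f≤g = z≤n
sum-mono-≤ {suc k} f≤g = +-mono-≤ (f≤g zero) (sum-mono-≤ (f≤g ∘ suc))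

term≤sum : ∀ {k} (f : Fin k → ℕ) i → f i ≤ sum f
term≤sum f zero    = m≤m+n _ _
term≤sum f (suc i) = ≤-trans (term≤sum (f ∘ suc) i) (m≤n+m _ _)

two-terms≤sum : ∀ {k} (f : Fin k → ℕ) {i j} → i ≢ j → f i + f j ≤ sum f
two-terms≤sum f {zero}  {zero}  i≢j = contradiction refl i≢j
two-terms≤sum f {zero}  {suc j} _   = +-monoʳ-≤ (f zero) (term≤sum (f ∘ suc) j)
two-terms≤sum f {suc i} {zero}  _   =
  ≤-trans (≤-reflexive (+-comm (f (suc i)) (f zero))) (+-monoʳ-≤ (f zero) (term≤sum (f ∘ suc) i))
two-terms≤sum f {suc i} {suc j} i≢j =
  ≤-trans (two-terms≤sum (f ∘ suc) (i≢j ∘ cong suc)) (m≤n+m _ _)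

sum-exchange-≤ : ∀ {k} {f g : Fin k → ℕ} → (∀ i → f i ≤ g i) → ∀ r → g r + sum f ≤ f r + sum g
sum-exchange-≤ {f = f} {g} f≤g zero =
  ≤-trans (≤-reflexive (x∙yz≈y∙xz (g zero) (f zero) _))
          (+-monoʳ-≤ (f zero) (+-monoʳ-≤ (g zero) (sum-mono-≤ (f≤g ∘ suc))))
sum-exchange-≤ {f = f} {g} f≤g (suc r) = begin
  g (suc r) + (f zero + sum (f ∘ suc)) ≡⟨ x∙yz≈y∙xz (g (suc r)) (f zero) _ ⟩
  f zero + (g (suc r) + sum (f ∘ suc)) ≤⟨ +-mono-≤ (f≤g zero) (sum-exchange-≤ (f≤g ∘ suc) r) ⟩
  g zero + (f (suc r) + sum (g ∘ suc)) ≡⟨ x∙yz≈y∙xz (g zero) (f (suc r)) _ ⟩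
  f (suc r) + (g zero + sum (g ∘ suc)) ∎
  where open ≤-Reasoning

count : ∀ {k} → (Fin k → Bool) → ℕ
count p = sum (λ i → b2n (p i))

count+count-not : ∀ {k} (p : Fin k → Bool) → count p + count (not ∘ p) ≡ k
count+count-not {k} p = begin
  count p + count (not ∘ p)             ≡⟨ ∑-distrib-+ (b2n ∘ p) (b2n ∘ not ∘ p) ⟨
  sum (λ i → b2n (p i) + b2n (not (p i))) ≡⟨ sum-cong-≗ (b2n+b2n-not ∘ p) ⟩
  ∑[ i < k ] 1                          ≡⟨ sum-const k 1 ⟩
  k * 1                                 ≡⟨ *-identityʳ k ⟩
  k                                     ∎
  where
  open ≡-Reasoning
  b2n+b2n-not : ∀ x → b2n x + b2n (not x) ≡ 1
  b2n+b2n-not true  = refl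
  b2n+b2n-not false = refl

count-≟ : ∀ {k} (p : Fin k) → count (λ i → does (i ≟ p)) ≡ 1
count-≟ {suc k} zero    = cong suc (sum-zero {k} λ _ → refl)
count-≟ {suc k} (suc p) = count-≟ p

count≤2 : ∀ {k} (g : Fin k → Bool) (p q : Fin k) →
          (∀ i → g i ≡ true → i ≢ p → i ≡ q) → count g ≤ 2
count≤2 {k} g p q g⊆pq = begin
  count g                                  ≤⟨ sum-mono-≤ indicator-bound ⟩
  sum (λ i → b2n (is p i) + b2n (is q i))  ≡⟨ ∑-distrib-+ (b2n ∘ is p) (b2n ∘ is q) ⟩
  count (is p) + count (is q)              ≡⟨ cong₂ _+_ (count-≟ p) (count-≟ q) ⟩
  2                                        ∎
  where
  open ≤-Reasoning
  is : Fin k → Fin k → Bool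
  is p i = does (i ≟ p)
  indicator-bound : ∀ i → b2n (g i) ≤ b2n (is p i) + b2n (is q i)
  indicator-bound i with g i in gi | i ≟ p | i ≟ q
  ... | false | _      | _      = z≤n
  ... | true  | yes _  | _      = s≤s z≤n
  ... | true  | no _   | yes _  = s≤s z≤n
  ... | true  | no i≢p | no i≢q = contradiction (g⊆pq i gi i≢p) i≢q

count≤2⇒many-false : ∀ {k} (g : Fin k → Bool) → count g ≤ 2 → k ≤ count (not ∘ g) + 2
count≤2⇒many-false {k} g g≤2 = begin
  k                         ≡⟨ count+count-not g ⟨
  count g + count (not ∘ g) ≤⟨ +-monoˡ-≤ _ g≤2 ⟩
  2 + count (not ∘ g)       ≡⟨ +-comm 2 _ ⟩
  count (not ∘ g) + 2       ∎
  where open ≤-Reasoning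

_≟ᵥ_ : ∀ {n} → DecidableEquality (V n)
_≟ᵥ_ = ≡-dec _≟_ (≡-dec _≟_ (≡-dec _≟_ _≟_))

adjG? : ∀ {n} (x y : VG n) → Dec (AdjG x y)
adjG? (a , b) (a' , b') = (a ≟ a' ×-dec ¬? (b ≟ b')) ⊎-dec (¬? (a ≟ a') ×-dec b ≟ b')

adj? : ∀ {n} (x y : V n) → Dec (Adj x y)
adj? (a , b , c , d) (a' , b' , c' , d') = adjG? (a , b) (a' , b') ×-dec adjG? (c , d) (c' , d')

anyV? : ∀ {n} {P : V n → Set} → (∀ v → Dec (P v)) → Dec (Σ (V n) P)
anyV? P? with any? (λ a → any? λ b → any? λ c → any? λ d → P? (a , b , c , d))
... | yes (a , b , c , d , p) = yes ((a , b , c , d) , p)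
... | no ¬p                   = no λ { ((a , b , c , d) , p) → ¬p (a , b , c , d , p) }

Dominated : ∀ {n} → VSet n → V n → Set
Dominated {n} D w = w ∈ D ⊎ Σ (V n) λ u → u ∈ D × Adj w u

dominated? : ∀ {n} (D : VSet n) w → Dec (Dominated D w)
dominated? D w = (D w Bool.≟ true) ⊎-dec anyV? λ u → (D u Bool.≟ true) ×-dec adj? w u

delete : ∀ {n} → V n → VSet n → VSet n
delete x D v = if does (v ≟ᵥ x) then false else D v

PrivateNeighbour : ∀ {n} → VSet n → V n → V n → Set
PrivateNeighbour D x w = ¬ Dominated (delete x D) w

∈-delete : ∀ {n} {D : VSet n} {x u} → u ≢ x → u ∈ D → u ∈ delete x D
∈-delete {x = x} {u} u≢x u∈D with u ≟ᵥ x
... | yes u≡x = contradiction u≡x u≢x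
... | no _    = u∈D

private-neighbour-exists : ∀ {n} {D : VSet n} {x} → MinimalDominating D → x ∈ D →
                           ∃[ w ] PrivateNeighbour D x w
private-neighbour-exists {D = D} {x} (_ , minimal) x∈D
  with anyV? (λ w → ¬? (dominated? (delete x D) w))
... | yes found = found
... | no none   = ⊥-elim (minimal (delete x D , delete-⊆ , (x , x∈D , x∉delete) , dominating))
  where
  delete-⊆ : delete x D ⊆ D
  delete-⊆ v v∈ with v ≟ᵥ x
  ... | no _ = v∈
  x∉delete : x ∉ delete x D
  x∉delete with x ≟ᵥ x
  ... | yes _  = refl
  ... | no x≢x = contradiction refl x≢x
  dominating : Dominating (delete x D)
  dominating w with dominated? (delete x D) w
  ... | yes dom = dom
  ... | no ¬dom = ⊥-elim (none (w , ¬dom))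

private⇒unique-dominator : ∀ {n} {D : VSet n} {x w u} → PrivateNeighbour D x w →
                           u ∈ D → Adj w u → u ≡ x
private⇒unique-dominator {D = D} {x} {u = u} pn u∈D w~u with u ≟ᵥ x
... | yes u≡x = u≡x
... | no u≢x  = ⊥-elim (pn (inj₂ (u , ∈-delete {D = D} u≢x u∈D , w~u)))

private⇒closed-neighbour : ∀ {n} {D : VSet n} {x w} → Dominating D → PrivateNeighbour D x w →
                           w ≡ x ⊎ Adj w x
private⇒closed-neighbour {x = x} {w} dom pn with dom w
... | inj₂ (u , u∈D , w~u) = inj₂ (subst (Adj w) (private⇒unique-dominator pn u∈D w~u) w~u)
... | inj₁ w∈D with w ≟ᵥ x
...   | yes w≡x = inj₁ w≡x
...   | no w≢x  = ⊥-elim (pn (inj₁ w∈D))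

blockCount : ∀ {n} → Fin 2 → Fin 2 → VSet n → ℕ
blockCount {n} i j F = ∑[ b < n ] ∑[ d < n ] b2n (F (i , b , j , d))

blockCount-empty : ∀ {n} i j (F : VSet n) → (∀ b d → F (i , b , j , d) ≡ false) → blockCount i j F ≡ 0
blockCount-empty i j F F≡∅ = sum-zero λ b → sum-zero λ d → cong b2n (F≡∅ b d)

card≡sum-blockCount : ∀ {n} (F : VSet n) → card F ≡ ∑[ i < 2 ] ∑[ j < 2 ] blockCount i j F
card≡sum-blockCount {n} F = begin
  card F                                                 ≡⟨ card-as-sum ⟩
  ∑[ a < 2 ] ∑[ b < n ] ∑[ c < 2 ] ∑[ d < n ] x a b c d ≡⟨ sum-cong-≗ (λ a → ∑-comm (λ b c → ∑[ d < n ] x a b c d)) ⟩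
  ∑[ a < 2 ] ∑[ c < 2 ] blockCount a c F                 ∎
  where
  open ≡-Reasoning
  x : Fin 2 → Fin n → Fin 2 → Fin n → ℕ
  x a b c d = b2n (F (a , b , c , d))
  card-as-sum : card F ≡ ∑[ a < 2 ] ∑[ b < n ] ∑[ c < 2 ] ∑[ d < n ] x a b c d
  card-as-sum = sumFin-cong 2 λ a → sumFin-cong n λ b → sumFin-cong 2 λ c → sumFin≡sum n (x a b c)

card-when-N₁₁-empty : ∀ {n} (F : VSet n) → (∀ b d → F (suc zero , b , suc zero , d) ≡ false) →
  card F ≡ blockCount zero zero F + (blockCount (suc zero) zero F + blockCount zero (suc zero) F)
card-when-N₁₁-empty F F₁₁≡∅ = begin
  card F                                        ≡⟨ card≡sum-blockCount F ⟩
  (F₀₀ + (F₀₁ + 0)) + ((F₁₀ + (F₁₁ + 0)) + 0)   ≡⟨ cong (λ z → (F₀₀ + (F₀₁ + 0)) + ((F₁₀ + (z + 0)) + 0))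
                                                        (blockCount-empty (suc zero) (suc zero) F F₁₁≡∅) ⟩
  (F₀₀ + (F₀₁ + 0)) + ((F₁₀ + 0) + 0)           ≡⟨ cong₂ _+_ (cong (F₀₀ +_) (+-identityʳ F₀₁))
                                                             (trans (+-identityʳ _) (+-identityʳ F₁₀)) ⟩
  (F₀₀ + F₀₁) + F₁₀                             ≡⟨ +-assoc F₀₀ F₀₁ F₁₀ ⟩
  F₀₀ + (F₀₁ + F₁₀)                             ≡⟨ cong (F₀₀ +_) (+-comm F₀₁ F₁₀) ⟩
  F₀₀ + (F₁₀ + F₀₁)                             ∎
  where
  open ≡-Reasoning
  F₀₀ F₁₀ F₀₁ F₁₁ : ℕ
  F₀₀ = blockCount zero zero F
  F₁₀ = blockCount (suc zero) zero F
  F₀₁ = blockCount zero (suc zero) F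
  F₁₁ = blockCount (suc zero) (suc zero) F

card-block₁₀ : ∀ {n} (D : VSet n) → card (block (suc zero) zero D) ≡ blockCount (suc zero) zero D
card-block₁₀ D = begin
  card D₁₀                                                          ≡⟨ card-when-N₁₁-empty D₁₀ (λ _ _ → refl) ⟩
  blockCount zero zero D₁₀ + (|B| + blockCount zero (suc zero) D₁₀) ≡⟨ cong₂ (λ x y → x + (|B| + y))
                                                                         (blockCount-empty zero zero D₁₀ λ _ _ → refl)
                                                                         (blockCount-empty zero (suc zero) D₁₀ λ _ _ → refl) ⟩
  |B| + 0                                                           ≡⟨ +-identityʳ |B| ⟩
  |B|                                                               ∎
  where
  open ≡-Reasoning
  D₁₀ : VSet _
  D₁₀ = block (suc zero) zero D
  |B| : ℕ
  |B| = blockCount (suc zero) zero D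

card-block₀₁ : ∀ {n} (D : VSet n) → card (block zero (suc zero) D) ≡ blockCount zero (suc zero) D
card-block₀₁ D = begin
  card D₀₁                                                          ≡⟨ card-when-N₁₁-empty D₀₁ (λ _ _ → refl) ⟩
  blockCount zero zero D₀₁ + (blockCount (suc zero) zero D₀₁ + |C|) ≡⟨ cong₂ (λ x y → x + (y + |C|))
                                                                         (blockCount-empty zero zero D₀₁ λ _ _ → refl)
                                                                         (blockCount-empty (suc zero) zero D₀₁ λ _ _ → refl) ⟩
  |C|                                                               ∎
  where
  open ≡-Reasoning
  D₀₁ : VSet _
  D₀₁ = block zero (suc zero) D
  |C| : ℕ
  |C| = blockCount zero (suc zero) D

card-∖-block₀₀ : ∀ {n} (D : VSet n) → Empty (block (suc zero) (suc zero) D) →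
  card (D ∖ block zero zero D) ≡ blockCount (suc zero) zero D + blockCount zero (suc zero) D
card-∖-block₀₀ D D₁₁≡∅ = trans (card-when-N₁₁-empty rest (λ b d → D₁₁≡∅ (suc zero , b , suc zero , d)))
  (cong (_+ (blockCount (suc zero) zero D + blockCount zero (suc zero) D))
        (blockCount-empty zero zero rest λ b d → ∖-self (D (zero , b , zero , d))))
  where
  rest : VSet _
  rest = D ∖ block zero zero D
  ∖-self : ∀ x → (if x then false else x) ≡ false
  ∖-self true  = refl
  ∖-self false = refl

card≡block₀₀+card-∖-block₀₀ : ∀ {n} (D : VSet n) → Empty (block (suc zero) (suc zero) D) →
  card D ≡ blockCount zero zero D + card (D ∖ block zero zero D)
card≡block₀₀+card-∖-block₀₀ D D₁₁≡∅ =
  trans (card-when-N₁₁-empty D (λ b d → D₁₁≡∅ (suc zero , b , suc zero , d)))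
        (cong (blockCount zero zero D +_) (sym (card-∖-block₀₀ D D₁₁≡∅)))

two-others : ∀ {m} (b : Fin (3 + m)) → ∃[ r ] ∃[ r' ] r ≢ r' × r ≢ b × r' ≢ b
two-others zero             = suc zero , suc (suc zero) , (λ ()) , (λ ()) , (λ ())
two-others (suc zero)       = zero , suc (suc zero) , (λ ()) , (λ ()) , (λ ())
two-others (suc (suc b))    = zero , suc zero , (λ ()) , (λ ()) , (λ ())

module D₀₀-Matrix {m} (D : VSet (3 + m)) where

  N : ℕ
  N = 3 + m

  A B C : Fin N → Fin N → Bool
  A b d = D (zero , b , zero , d)
  B b d = D (suc zero , b , zero , d)
  C b d = D (zero , b , suc zero , d)

  rowCount colCount rowZeros colZeros : Fin N → ℕ
  rowCount r = count (A r)
  colCount c = count (λ b → A b c)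
  rowZeros r = count (not ∘ A r)
  colZeros c = count (λ b → not (A b c))

  zeros : ℕ
  zeros = sum rowZeros

  SparseRow SparseCol : Fin N → Set
  SparseRow r = rowCount r ≤ 2
  SparseCol c = colCount c ≤ 2

  entries+zeros : sum rowCount + zeros ≡ N * N
  entries+zeros = begin
    sum rowCount + sum rowZeros             ≡⟨ ∑-distrib-+ rowCount rowZeros ⟨
    ∑[ r < N ] (rowCount r + rowZeros r)    ≡⟨ sum-cong-≗ (count+count-not ∘ A) ⟩
    ∑[ r < N ] N                            ≡⟨ sum-const N N ⟩
    N * N                                   ∎
    where open ≡-Reasoning

  two-sparse-rows : ∀ {r r'} → r ≢ r' → SparseRow r → SparseRow r' → N + N ≤ zeros + 4
  two-sparse-rows {r} {r'} r≢r' sr sr' = begin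
    N + N                                 ≤⟨ +-mono-≤ (count≤2⇒many-false (A r) sr) (count≤2⇒many-false (A r') sr') ⟩
    (rowZeros r + 2) + (rowZeros r' + 2)  ≡⟨ interchange (rowZeros r) 2 (rowZeros r') 2 ⟩
    (rowZeros r + rowZeros r') + 4        ≤⟨ +-monoˡ-≤ 4 (two-terms≤sum rowZeros r≢r') ⟩
    zeros + 4                             ∎
    where open ≤-Reasoning

  two-sparse-cols : ∀ {c c'} → c ≢ c' → SparseCol c → SparseCol c' → N + N ≤ zeros + 4
  two-sparse-cols {c} {c'} c≢c' sc sc' = begin
    N + N                                 ≤⟨ +-mono-≤ (count≤2⇒many-false (λ b → A b c) sc)
                                                      (count≤2⇒many-false (λ b → A b c') sc') ⟩
    (colZeros c + 2) + (colZeros c' + 2)  ≡⟨ interchange (colZeros c) 2 (colZeros c') 2 ⟩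
    (colZeros c + colZeros c') + 4        ≤⟨ +-monoˡ-≤ 4 (two-terms≤sum colZeros c≢c') ⟩
    sum colZeros + 4                      ≡⟨ cong (_+ 4) (∑-comm (λ b d → b2n (not (A b d)))) ⟨
    zeros + 4                             ∎
    where open ≤-Reasoning

  sparse-row-and-col : ∀ {r c} → SparseRow r → SparseCol c → N + N ≤ zeros + 5
  sparse-row-and-col {r} {c} sr sc = begin
    N + N                                 ≤⟨ +-mono-≤ (count≤2⇒many-false (A r) sr)
                                                      (count≤2⇒many-false (λ b → A b c) sc) ⟩
    (rowZeros r + 2) + (colZeros c + 2)   ≡⟨ interchange (rowZeros r) 2 (colZeros c) 2 ⟩
    (rowZeros r + colZeros c) + 4         ≤⟨ +-monoˡ-≤ 4 cross ⟩
    (b2n (not (A r c)) + zeros) + 4       ≤⟨ +-monoˡ-≤ 4 (+-monoˡ-≤ zeros (b2n≤1 (not (A r c)))) ⟩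
    suc zeros + 4                         ≡⟨ +-suc zeros 4 ⟨
    zeros + 5                             ∎
    where
    open ≤-Reasoning
    b2n≤1 : ∀ x → b2n x ≤ 1
    b2n≤1 true  = ≤-refl
    b2n≤1 false = z≤n
    cross : rowZeros r + colZeros c ≤ b2n (not (A r c)) + zeros
    cross = sum-exchange-≤ (λ b → term≤sum (λ d → b2n (not (A b d))) c) r

  module _ (minimal : MinimalDominating D) (few-zeros : zeros + 5 < N + N) where

    rows-not-both-sparse : ∀ {r r'} → r ≢ r' → SparseRow r → SparseRow r' → ⊥
    rows-not-both-sparse r≢r' sr sr' =
      <⇒≱ few-zeros (≤-trans (two-sparse-rows r≢r' sr sr') (+-monoʳ-≤ zeros (n≤1+n 4)))

    cols-not-both-sparse : ∀ {c c'} → c ≢ c' → SparseCol c → SparseCol c' → ⊥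
    cols-not-both-sparse c≢c' sc sc' =
      <⇒≱ few-zeros (≤-trans (two-sparse-cols c≢c' sc sc') (+-monoʳ-≤ zeros (n≤1+n 4)))

    row-and-col-not-both-sparse : ∀ {r c} → SparseRow r → SparseCol c → ⊥
    row-and-col-not-both-sparse sr sc = <⇒≱ few-zeros (sparse-row-and-col sr sc)

    entry-on-sparse-line : ∀ {b d} → A b d ≡ true →
                           (∃[ f ] f ≢ b × B f d ≡ true) ⊎ (∃[ e ] e ≢ d × C b e ≡ true) →
                           SparseRow b ⊎ SparseCol d
    entry-on-sparse-line {b} {d} Abd shared with rowCount b ≤? 2 | colCount d ≤? 2
    ... | yes sr | _      = inj₁ sr
    ... | no _   | yes sc = inj₂ sc
    ... | no ¬sr | no ¬sc = ⊥-elim (no-private-neighbour (private-neighbour-exists {x = x} minimal Abd))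
      where
      x : V N
      x = zero , b , zero , d

      no-private-neighbour : ∃[ w ] PrivateNeighbour D x w → ⊥
      no-private-neighbour ((suc (suc ()) , _) , _)
      no-private-neighbour ((_ , _ , suc (suc ()) , _) , _)
      no-private-neighbour ((zero , b' , zero , d') , pn) with two-others b'
      ... | r , r' , r≢r' , r≢b' , r'≢b' = rows-not-both-sparse r≢r' (sparse r≢b') (sparse r'≢b')
        where
        sparse : ∀ {r} → r ≢ b' → SparseRow r
        sparse {r} r≢b' = count≤2 (A r) d' d support
          where
          support : ∀ d'' → A r d'' ≡ true → d'' ≢ d' → d'' ≡ d
          support d'' Ard'' d''≢d'
            with private⇒unique-dominator pn Ard'' (inj₁ (refl , r≢b' ∘ sym) , inj₁ (refl , d''≢d' ∘ sym))
          ... | refl = refl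
      no-private-neighbour ((suc zero , b' , zero , d') , pn) with private⇒closed-neighbour (proj₁ minimal) pn
      ... | inj₁ ()
      ... | inj₂ (inj₁ (() , _) , _)
      ... | inj₂ (inj₂ (_ , refl) , _) = ¬sr (count≤2 (A b) d' d support)
        where
        support : ∀ d'' → A b d'' ≡ true → d'' ≢ d' → d'' ≡ d
        support d'' Abd'' d''≢d'
          with private⇒unique-dominator pn Abd'' (inj₂ ((λ ()) , refl) , inj₁ (refl , d''≢d' ∘ sym))
        ... | refl = refl
      no-private-neighbour ((zero , b' , suc zero , d') , pn) with private⇒closed-neighbour (proj₁ minimal) pn
      ... | inj₁ ()
      ... | inj₂ (_ , inj₁ (() , _))
      ... | inj₂ (_ , inj₂ (_ , refl)) = ¬sc (count≤2 (λ b'' → A b'' d) b' b support)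
        where
        support : ∀ b'' → A b'' d ≡ true → b'' ≢ b' → b'' ≡ b
        support b'' Ab''d b''≢b'
          with private⇒unique-dominator pn Ab''d (inj₁ (refl , b''≢b' ∘ sym) , inj₂ ((λ ()) , refl))
        ... | refl = refl
      no-private-neighbour ((suc zero , b' , suc zero , d') , pn) with private⇒closed-neighbour (proj₁ minimal) pn
      ... | inj₁ ()
      ... | inj₂ (inj₁ (() , _) , _)
      ... | inj₂ (_ , inj₁ (() , _))
      ... | inj₂ (inj₂ (_ , refl) , inj₂ (_ , refl)) = dominated-twice shared
        where
        dominated-twice : (∃[ f ] f ≢ b × B f d ≡ true) ⊎ (∃[ e ] e ≢ d × C b e ≡ true) → ⊥
        dominated-twice (inj₁ (f , f≢b , Bfd))
          with private⇒unique-dominator pn Bfd (inj₁ (refl , f≢b ∘ sym) , inj₂ ((λ ()) , refl))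
        ... | ()
        dominated-twice (inj₂ (e , e≢d , Cbe))
          with private⇒unique-dominator pn Cbe (inj₂ ((λ ()) , refl) , inj₁ (refl , e≢d ∘ sym))
        ... | ()

    sparse-row-unique : Fin N → ∃[ g ] ∀ r → SparseRow r → r ≡ g
    sparse-row-unique f with any? (λ r → rowCount r ≤? 2)
    ... | no none = f , λ r sr → ⊥-elim (none (r , sr))
    ... | yes (g , sg) = g , unique
      where
      unique : ∀ r → SparseRow r → r ≡ g
      unique r sr with r ≟ g
      ... | yes r≡g = r≡g
      ... | no r≢g  = ⊥-elim (rows-not-both-sparse r≢g sr sg)

    B-or-C-empty : (∃[ r ] ∃[ e ] C r e ≡ true) → (∃[ f ] ∃[ c ] B f c ≡ true) → ⊥
    B-or-C-empty (r , e , Cre) (f , c , Bfc) with colCount c ≤? 2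
    ... | yes sc = row-and-col-not-both-sparse (count≤2 (A r) e c row-support) sc
      where
      row-support : ∀ d → A r d ≡ true → d ≢ e → d ≡ c
      row-support d Ard d≢e with d ≟ c
      ... | yes d≡c = d≡c
      ... | no d≢c with entry-on-sparse-line Ard (inj₂ (e , d≢e ∘ sym , Cre))
      ...   | inj₁ sr = ⊥-elim (row-and-col-not-both-sparse sr sc)
      ...   | inj₂ sd = ⊥-elim (cols-not-both-sparse d≢c sd sc)
    ... | no ¬sc with sparse-row-unique f
    ...   | g , unique-sparse = ¬sc (count≤2 (λ b → A b c) f g col-support)
      where
      col-support : ∀ b → A b c ≡ true → b ≢ f → b ≡ g
      col-support b Abc b≢f with entry-on-sparse-line Abc (inj₁ (f , b≢f ∘ sym , Bfc))
      ... | inj₁ sr = unique-sparse b sr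
      ... | inj₂ sc = ⊥-elim (¬sc sc)

m<n≤2o∸43⇒m+5<o+o : ∀ {m n o} → 43 ≤ 2 * o → m < n → n ≤ 2 * o ∸ 43 → m + 5 < o + o
m<n≤2o∸43⇒m+5<o+o {m} {n} {o} 43≤2o m<n n≤ = begin-strict
  m + 5   ≤⟨ +-monoʳ-≤ m (m≤m+n 5 38) ⟩
  m + 43  <⟨ m≤o∸n⇒m+n≤o (suc m) 43≤2o (≤-trans m<n n≤) ⟩
  2 * o   ≡⟨ cong (o +_) (+-identityʳ o) ⟩
  o + o   ∎
  where open ≤-Reasoning

block-nonempty : ∀ {n} {i j} {D : VSet n} → NonEmpty (block i j D) → ∃[ b ] ∃[ d ] D (i , b , j , d) ≡ true
block-nonempty {i = i} {j} ((a , b , c , d) , v∈) with a ≟ i | c ≟ j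
... | yes refl | yes refl = b , d , v∈
... | yes _    | no _     = contradiction v∈ λ ()
... | no _     | _        = contradiction v∈ λ ()

lemma19 : (n : ℕ) → 71 ≤ n → (D : VSet n) → MinimalDominating D → n * n < card D
    → NonEmpty (block zero zero D) → NonEmpty (block (suc zero) zero D)
    → NonEmpty (block zero (suc zero) D) → Empty (block (suc zero) (suc zero) D)
    → card (D ∖ block zero zero D) ≡ card (block (suc zero) zero D) + card (block zero (suc zero) D)
    × 2 * n ∸ 43 < card (D ∖ block zero zero D)
lemma19 0 ()
lemma19 1 (s≤s ())
lemma19 2 (s≤s (s≤s ()))
lemma19 (suc (suc (suc m))) 71≤n D minimal big _ ne₁₀ ne₀₁ D₁₁≡∅ = rest≡D₁₀+D₀₁ , bound
  where
  open D₀₀-Matrix D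

  rest≡D₁₀+D₀₁ : card (D ∖ block zero zero D)
               ≡ card (block (suc zero) zero D) + card (block zero (suc zero) D)
  rest≡D₁₀+D₀₁ = trans (card-∖-block₀₀ D D₁₁≡∅) (sym (cong₂ _+_ (card-block₁₀ D) (card-block₀₁ D)))

  zeros<rest : zeros < card (D ∖ block zero zero D)
  zeros<rest = +-cancelˡ-< (sum rowCount) zeros (card (D ∖ block zero zero D))
    (subst₂ _<_ (sym entries+zeros) (card≡block₀₀+card-∖-block₀₀ D D₁₁≡∅) big)

  43≤2N : 43 ≤ 2 * N
  43≤2N = ≤-trans (m≤m+n 43 28) (≤-trans 71≤n (m≤m+n N (N + 0)))

  bound : 2 * N ∸ 43 < card (D ∖ block zero zero D)
  bound = decidable-stable (2 * N ∸ 43 <? card (D ∖ block zero zero D)) λ ¬bound →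
    B-or-C-empty minimal (m<n≤2o∸43⇒m+5<o+o {o = N} 43≤2N zeros<rest (≮⇒≥ ¬bound))
                 (block-nonempty ne₀₁) (block-nonempty ne₁₀)
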